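{- If $F$ is Pascal finite, then for every prime number $p$ the reduced map $\overline{F}^p$ is Pascal finite, and the inverse of $\overline{F}^p$ is exactly the reduction modulo $p$ of the inverse of $F$, i.e. $\overline{F^{ -1}}^p=\big(\overline{F}^p\big)^{ -1}$.
   Context: Let $F=(F_1,\ldots,F_n)\in\mathbb{Z}[X]^n$, $X=(X_1,\ldots,X_n)$, be a polynomial map of the form $F_i(X)=X_i+H_i(X)$, $i=1,\ldots,n$, where each $H_i$ is a polynomial of lower degree (order of vanishing) at least $2$. For a field (or ring) $K$ and $F\in K[X]^n$ define the endomorphism $\sigma_F(P)=P\circ F$ of $K[X]^n$ and $\Delta_F(P)=\sigma_F(P)-P$, and set $P_l=\Delta_F^l(Id)$ (so $P_0=X$, $P_{k+1}=P_k\circ F-P_k$). The map $F$ is called Pascal finite if there exists $m$ with $P_m=0$; then $F$ is invertible with inverse $G=\sum_{l=0}^{m-1}(-1)^lP_l$. For a prime $p$, $\overline{F}^p\in\mathbb{F}_p[X]^n$ denotes the map obtained by reducing every coefficient of each $F_i$ modulo $p$ (similarly $\overline{P}^p$ for other polynomial maps $P$). Applying the same construction to $\overline{F}^p$ gives the sequence $V_0=X$, $V_{k+1}=V_k\circ\overline{F}^p-V_k$, and one has $V_k=\overline{P_k}^p$ for all $k$. -}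

module Defs where

open import Level using (0ℓ)
open import Algebra.Bundles.Raw using (RawRing)
open import Data.Nat as ℕ using (ℕ; zero; suc; NonZero; _≤_)
open import Data.Nat.DivMod using (_mod_)
import Data.Nat.Primality
open Data.Nat.Primality using (Prime)
open import Data.Fin using (Fin; toℕ) renaming (zero to fzero; suc to fsuc)
open import Data.Integer as ℤ using (ℤ; +_; -[1+_])
open import Data.List using (List; []; _∷_; foldr)
import Data.List as List
open import Data.Product using (Σ; _×_)
open import Relation.Binary.PropositionalEquality using (_≡_)

module 𝔽 (p : ℕ) .{{_ : NonZero p}} where
  Carrier : Set
  Carrier = Fin p

  _+_ _*_ : Carrier → Carrier → Carrier
  a + b = (toℕ a ℕ.+ toℕ b) mod p
  a * b = (toℕ a ℕ.* toℕ b) mod p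

  -_ : Carrier → Carrier
  - a = (p ℕ.∸ toℕ a) mod p

  rawRing : RawRing 0ℓ 0ℓ
  rawRing = record
    { Carrier = Carrier ; _≈_ = _≡_ ; _+_ = _+_ ; _*_ = _*_ ; -_ = -_
    ; 0# = 0 mod p ; 1# = 1 mod p }

  reduce : ℤ → Carrier
  reduce (+ n)     = n mod p
  reduce -[1+ n ]  = - (suc n mod p)

prime⇒nonZero : ∀ {p} → Prime p → NonZero p
prime⇒nonZero {p} (Data.Nat.Primality.prime {{nt}} _) = ℕ.nonTrivial⇒nonZero p {{nt}}

𝔽ₚ : (p : ℕ) → Prime p → RawRing 0ℓ 0ℓ
𝔽ₚ p pp = 𝔽.rawRing p {{prime⇒nonZero pp}}

reduceₚ : (p : ℕ) (pp : Prime p) → ℤ → RawRing.Carrier (𝔽ₚ p pp)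
reduceₚ p pp = 𝔽.reduce p {{prime⇒nonZero pp}}

-- Poly 0 = R (con c),  Poly (suc n) = (Poly n)[X₀] as a dense coefficient
-- list (poly cs; entry k = coefficient of X₀^k, a polynomial in the
-- remaining variables).
-- Equality of polynomials is equality of all coefficients (see _≈P_),
-- so representations differing by trailing zeros are identified.

module PolyOver (R : RawRing 0ℓ 0ℓ) where
  open RawRing R

  data Poly : ℕ → Set where
    con  : Carrier → Poly zero
    poly : ∀ {n} → List (Poly n) → Poly (suc n)

  zeroP : ∀ {n} → Poly n
  zeroP {zero}  = con 0#
  zeroP {suc n} = poly []

  constP : ∀ {n} → Carrier → Poly n
  constP {zero}  c = con c
  constP {suc n} c = poly (constP c ∷ [])

  oneP : ∀ {n} → Poly n
  oneP = constP 1#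

  addP : ∀ {n} → Poly n → Poly n → Poly n
  addL : ∀ {n} → List (Poly n) → List (Poly n) → List (Poly n)
  addP (con a) (con b) = con (a + b)
  addP (poly xs) (poly ys) = poly (addL xs ys)
  addL [] ys = ys
  addL (x ∷ xs) [] = x ∷ xs
  addL (x ∷ xs) (y ∷ ys) = addP x y ∷ addL xs ys

  negP : ∀ {n} → Poly n → Poly n
  negL : ∀ {n} → List (Poly n) → List (Poly n)
  negP (con a)   = con (- a)
  negP (poly xs) = poly (negL xs)
  negL [] = []
  negL (x ∷ xs) = negP x ∷ negL xs

  subP : ∀ {n} → Poly n → Poly n → Poly n
  subP a b = addP a (negP b)

  mulP : ∀ {n} → Poly n → Poly n → Poly n
  mulL : ∀ {n} → List (Poly n) → List (Poly n) → List (Poly n)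
  scaleL : ∀ {n} → Poly n → List (Poly n) → List (Poly n)
  mulP (con a) (con b) = con (a * b)
  mulP (poly xs) (poly ys) = poly (mulL xs ys)
  mulL [] ys = []
  mulL (x ∷ xs) ys = addL (scaleL x ys) (zeroP ∷ mulL xs ys)
  scaleL x [] = []
  scaleL x (y ∷ ys) = mulP x y ∷ scaleL x ys

  -- the variable Xᵢ  (X₀ is the outermost variable)
  var : ∀ {n} → Fin n → Poly n
  var {suc n} fzero    = poly (zeroP ∷ oneP ∷ [])
  var {suc n} (fsuc i) = poly (var i ∷ [])

  substP : ∀ {n m} → Poly n → (Fin n → Poly m) → Poly m
  substL : ∀ {n m} → List (Poly n) → (Fin (suc n) → Poly m) → Poly m
  substP (con c)   F = constP c
  substP (poly cs) F = substL cs F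
  substL [] F = zeroP
  substL (c ∷ cs) F =
    addP (substP c (λ i → F (fsuc i))) (mulP (F fzero) (substL cs F))

  coeff : ∀ {n} → Poly n → (Fin n → ℕ) → Carrier
  coeffL : ∀ {n} → List (Poly n) → (Fin (suc n) → ℕ) → Carrier
  coeff (con c)   e = c
  coeff (poly cs) e = coeffL cs e
  coeffL [] e = 0#
  coeffL (c ∷ cs) e with e fzero
  ... | zero  = coeff c (λ i → e (fsuc i))
  ... | suc k = coeffL cs (λ { fzero → k ; (fsuc i) → e (fsuc i) })

  deg : ∀ {n} → (Fin n → ℕ) → ℕ
  deg {zero}  e = 0
  deg {suc n} e = e fzero ℕ.+ deg (λ i → e (fsuc i))

  _≈P_ : ∀ {n} → Poly n → Poly n → Set
  P ≈P Q = ∀ e → coeff P e ≈ coeff Q e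

  OrderAtLeast2 : ∀ {n} → Poly n → Set
  OrderAtLeast2 P = ∀ e → deg e ≤ 1 → coeff P e ≈ 0#

  PolyMap : ℕ → Set
  PolyMap n = Fin n → Poly n

  _≈M_ : ∀ {n} → PolyMap n → PolyMap n → Set
  P ≈M Q = ∀ i → P i ≈P Q i

  Id : ∀ {n} → PolyMap n
  Id = var

  0M : ∀ {n} → PolyMap n
  0M i = zeroP

  _∘M_ : ∀ {n} → PolyMap n → PolyMap n → PolyMap n
  (P ∘M F) i = substP (P i) F

  Δ : ∀ {n} → PolyMap n → PolyMap n → PolyMap n
  Δ F P i = subP ((P ∘M F) i) (P i)

  pascal : ∀ {n} → PolyMap n → ℕ → PolyMap n
  pascal F zero    = Id
  pascal F (suc l) = Δ F (pascal F l)

  PascalFinite : ∀ {n} → PolyMap n → Set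
  PascalFinite F = Σ ℕ (λ m → pascal F m ≈M 0M)

  IsInverse : ∀ {n} → PolyMap n → PolyMap n → Set
  IsInverse G F = ((G ∘M F) ≈M Id) × ((F ∘M G) ≈M Id)

mapPoly : {R S : RawRing 0ℓ 0ℓ} → (RawRing.Carrier R → RawRing.Carrier S) →
          ∀ {n} → PolyOver.Poly R n → PolyOver.Poly S n
mapPoly f (PolyOver.con c)   = PolyOver.con (f c)
mapPoly f (PolyOver.poly cs) = PolyOver.poly (mapL cs)
  where
  mapL : ∀ {n} → List (PolyOver.Poly _ n) → List (PolyOver.Poly _ n)
  mapL [] = []
  mapL (c ∷ cs) = mapPoly f c ∷ mapL cs

ℤR : RawRing 0ℓ 0ℓ
ℤR = ℤ.+-*-rawRing

module ℤX = PolyOver ℤR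

X+ : ∀ {n} → ℤX.PolyMap n → ℤX.PolyMap n
X+ H i = ℤX.addP (ℤX.var i) (H i)

reduceMap : (p : ℕ) (pp : Prime p) → ∀ {n} →
            ℤX.PolyMap n → PolyOver.PolyMap (𝔽ₚ p pp) n
reduceMap p pp P i = mapPoly {ℤR} {𝔽ₚ p pp} (reduceₚ p pp) (P i)

module Submission where

-- Reduction modulo p commutes with everything Pascal finiteness is made of.
--
-- The whole statement is an instance of one general principle: a map of
-- coefficient rings f : R → S preserving 0, 1, +, · and negation induces a
-- map of polynomials (mapPoly f) that commutes with addition, negation,
-- multiplication, the variables and substitution, and that acts on
-- coefficients by f.  Consequently it commutes with composition of
-- polynomial maps, with Δ_F, and hence with the Pascal sequence:
-- reducing P_l(F) gives P_l(reduced F).  Reducing the identity P_m = 0 then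
-- shows that the reduced map is Pascal finite, and reducing G ∘ F = Id and
-- F ∘ G = Id shows that the reduced G inverts the reduced F.
--
-- The corollary is the combination of the two.

open import Defs
open import Data.Nat using (ℕ)
open import Data.Nat.Primality using (Prime)
open import Data.Fin using (Fin)
open import Data.Product using (_×_)
open import Level using (0ℓ)
open import Algebra.Bundles.Raw using (RawRing)
open import Data.Nat as ℕ using (zero; suc; NonZero)
open import Data.Nat.DivMod using (_mod_; m<n⇒m%n≡m)
open import Data.Nat.Divisibility using (n∣m⇒m%n≡0)
import Data.Nat.Properties as ℕP
open import Data.Fin using (toℕ) renaming (zero to fzero; suc to fsuc)
open import Data.Fin.Properties using (toℕ-fromℕ<; toℕ-injective; toℕ<n)
open import Data.Integer as ℤ using (ℤ; +_; -[1+_]; ∣_∣)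
import Data.Integer.Properties as ℤP
open import Data.Integer.DivMod using (a≡a%ℕn+[a/ℕn]*n)
open import Data.Integer.Divisibility.Signed
  using (_∣_; divides; ∣⇒∣ᵤ; ∣m∣n⇒∣m+n; ∣m⇒∣-m; ∣m⇒∣m*n; ∣n⇒∣m*n)
open import Data.Integer.Solver using (module +-*-Solver)
open import Data.List using (List; []; _∷_)
open import Data.Product using (_,_)
open import Relation.Binary.PropositionalEquality

module PolynomialHomomorphism
  (R S : RawRing 0ℓ 0ℓ)
  (f : RawRing.Carrier R → RawRing.Carrier S)
  (f-0# : f (RawRing.0# R) ≡ RawRing.0# S)
  (f-1# : f (RawRing.1# R) ≡ RawRing.1# S)
  (f-+ : ∀ a b → f (RawRing._+_ R a b) ≡ RawRing._+_ S (f a) (f b))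
  (f-* : ∀ a b → f (RawRing._*_ R a b) ≡ RawRing._*_ S (f a) (f b))
  (f-neg : ∀ a → f (RawRing.-_ R a) ≡ RawRing.-_ S (f a))
  where

  module A = PolyOver R
  module B = PolyOver S

  mapP : ∀ {n} → A.Poly n → B.Poly n
  mapP = mapPoly {R} {S} f

  mapM : ∀ {n} → A.PolyMap n → B.PolyMap n
  mapM F i = mapP (F i)

  -- its action on coefficient lists, read off from mapP so that it agrees
  -- definitionally with the list helper inside mapPoly
  mapL : ∀ {n} → List (A.Poly n) → List (B.Poly n)
  mapL cs with mapP (A.poly cs)
  ... | B.poly ds = ds

  mapP-zeroP : ∀ {n} → mapP (A.zeroP {n}) ≡ B.zeroP
  mapP-zeroP {zero}  = cong B.con f-0#
  mapP-zeroP {suc n} = refl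

  mapP-constP : ∀ {n} c → mapP (A.constP {n} c) ≡ B.constP (f c)
  mapP-constP {zero}  c = refl
  mapP-constP {suc n} c = cong (λ q → B.poly (q ∷ [])) (mapP-constP c)

  mapP-var : ∀ {n} (i : Fin n) → mapP (A.var i) ≡ B.var i
  mapP-var {suc n} fzero =
    cong₂ (λ z o → B.poly (z ∷ o ∷ [])) mapP-zeroP
          (trans (mapP-constP _) (cong B.constP f-1#))
  mapP-var {suc n} (fsuc i) = cong (λ q → B.poly (q ∷ [])) (mapP-var i)

  mapP-addP : ∀ {n} (x y : A.Poly n) → mapP (A.addP x y) ≡ B.addP (mapP x) (mapP y)
  mapL-addL : ∀ {n} (xs ys : List (A.Poly n)) →
              mapL (A.addL xs ys) ≡ B.addL (mapL xs) (mapL ys)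
  mapP-addP (A.con a)   (A.con b)   = cong B.con (f-+ a b)
  mapP-addP (A.poly xs) (A.poly ys) = cong B.poly (mapL-addL xs ys)
  mapL-addL []       ys       = refl
  mapL-addL (x ∷ xs) []       = refl
  mapL-addL (x ∷ xs) (y ∷ ys) = cong₂ _∷_ (mapP-addP x y) (mapL-addL xs ys)

  mapP-negP : ∀ {n} (x : A.Poly n) → mapP (A.negP x) ≡ B.negP (mapP x)
  mapL-negL : ∀ {n} (xs : List (A.Poly n)) → mapL (A.negL xs) ≡ B.negL (mapL xs)
  mapP-negP (A.con a)   = cong B.con (f-neg a)
  mapP-negP (A.poly xs) = cong B.poly (mapL-negL xs)
  mapL-negL []       = refl
  mapL-negL (x ∷ xs) = cong₂ _∷_ (mapP-negP x) (mapL-negL xs)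

  mapP-mulP : ∀ {n} (x y : A.Poly n) → mapP (A.mulP x y) ≡ B.mulP (mapP x) (mapP y)
  mapL-mulL : ∀ {n} (xs ys : List (A.Poly n)) →
              mapL (A.mulL xs ys) ≡ B.mulL (mapL xs) (mapL ys)
  mapL-scaleL : ∀ {n} (x : A.Poly n) (ys : List (A.Poly n)) →
                mapL (A.scaleL x ys) ≡ B.scaleL (mapP x) (mapL ys)
  mapP-mulP (A.con a)   (A.con b)   = cong B.con (f-* a b)
  mapP-mulP (A.poly xs) (A.poly ys) = cong B.poly (mapL-mulL xs ys)
  mapL-mulL []       ys = refl
  mapL-mulL (x ∷ xs) ys =
    trans (mapL-addL (A.scaleL x ys) (A.zeroP ∷ A.mulL xs ys))
          (cong₂ B.addL (mapL-scaleL x ys) (cong₂ _∷_ mapP-zeroP (mapL-mulL xs ys)))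
  mapL-scaleL x []       = refl
  mapL-scaleL x (y ∷ ys) = cong₂ _∷_ (mapP-mulP x y) (mapL-scaleL x ys)

  mapP-substP : ∀ {n m} (P : A.Poly n) (F : Fin n → A.Poly m) →
                mapP (A.substP P F) ≡ B.substP (mapP P) (λ i → mapP (F i))
  mapP-substL : ∀ {n m} (cs : List (A.Poly n)) (F : Fin (suc n) → A.Poly m) →
                mapP (A.substL cs F) ≡ B.substL (mapL cs) (λ i → mapP (F i))
  mapP-substP (A.con c)   F = mapP-constP c
  mapP-substP (A.poly cs) F = mapP-substL cs F
  mapP-substL []       F = mapP-zeroP
  mapP-substL (c ∷ cs) F =
    trans (mapP-addP _ _)
      (cong₂ B.addP (mapP-substP c (λ i → F (fsuc i)))
        (trans (mapP-mulP (F fzero) _)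
               (cong (B.mulP (mapP (F fzero))) (mapP-substL cs F))))

  coeff-mapP : ∀ {n} (P : A.Poly n) e → B.coeff (mapP P) e ≡ f (A.coeff P e)
  coeffL-mapL : ∀ {n} (cs : List (A.Poly n)) e → B.coeffL (mapL cs) e ≡ f (A.coeffL cs e)
  coeff-mapP (A.con c)   e = refl
  coeff-mapP (A.poly cs) e = coeffL-mapL cs e
  coeffL-mapL []       e = sym f-0#
  coeffL-mapL (c ∷ cs) e with e fzero
  ... | zero  = coeff-mapP c _
  ... | suc k = coeffL-mapL cs _

  mapP-respects-coeff : ∀ {n} (P Q : A.Poly n) →
    (∀ e → A.coeff P e ≡ A.coeff Q e) → ∀ e → B.coeff (mapP P) e ≡ B.coeff (mapP Q) e
  mapP-respects-coeff P Q P≈Q e = begin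
    B.coeff (mapP P) e  ≡⟨ coeff-mapP P e ⟩
    f (A.coeff P e)     ≡⟨ cong f (P≈Q e) ⟩
    f (A.coeff Q e)     ≡⟨ coeff-mapP Q e ⟨
    B.coeff (mapP Q) e  ∎
    where open ≡-Reasoning

  mapM-∘M : ∀ {n} (G F : A.PolyMap n) i → mapP ((G A.∘M F) i) ≡ (mapM G B.∘M mapM F) i
  mapM-∘M G F i = mapP-substP (G i) F

  mapM-Δ : ∀ {n} (F P : A.PolyMap n) i → mapP (A.Δ F P i) ≡ B.Δ (mapM F) (mapM P) i
  mapM-Δ F P i = trans (mapP-addP _ _) (cong₂ B.addP (mapM-∘M P F i) (mapP-negP (P i)))

  mapM-pascal : ∀ {n} (F : A.PolyMap n) l i → mapP (A.pascal F l i) ≡ B.pascal (mapM F) l i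
  mapM-pascal F zero    i = mapP-var i
  mapM-pascal F (suc l) i =
    trans (mapM-Δ F (A.pascal F l) i)
          (cong (λ q → B.subP (B.substP q (mapM F)) q) (mapM-pascal F l i))

  mapM-pascal-vanishes : ∀ {n} (F : A.PolyMap n) m →
    (∀ i e → A.coeff (A.pascal F m i) e ≡ A.coeff A.zeroP e) →
    ∀ i e → B.coeff (B.pascal (mapM F) m i) e ≡ B.coeff B.zeroP e
  mapM-pascal-vanishes F m Pₘ≈0 i e = begin
    B.coeff (B.pascal (mapM F) m i) e  ≡⟨ cong (λ q → B.coeff q e) (mapM-pascal F m i) ⟨
    B.coeff (mapP (A.pascal F m i)) e  ≡⟨ mapP-respects-coeff (A.pascal F m i) A.zeroP (Pₘ≈0 i) e ⟩
    B.coeff (mapP A.zeroP) e           ≡⟨ cong (λ q → B.coeff q e) mapP-zeroP ⟩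
    B.coeff B.zeroP e                  ∎
    where open ≡-Reasoning

  mapM-∘M-Id : ∀ {n} (G F : A.PolyMap n) →
    (∀ i e → A.coeff ((G A.∘M F) i) e ≡ A.coeff (A.var i) e) →
    ∀ i e → B.coeff ((mapM G B.∘M mapM F) i) e ≡ B.coeff (B.var i) e
  mapM-∘M-Id G F G∘F≈Id i e = begin
    B.coeff ((mapM G B.∘M mapM F) i) e  ≡⟨ cong (λ q → B.coeff q e) (mapM-∘M G F i) ⟨
    B.coeff (mapP ((G A.∘M F) i)) e     ≡⟨ mapP-respects-coeff ((G A.∘M F) i) (A.var i) (G∘F≈Id i) e ⟩
    B.coeff (mapP (A.var i)) e          ≡⟨ cong (λ q → B.coeff q e) (mapP-var i) ⟩
    B.coeff (B.var i) e                 ∎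
    where open ≡-Reasoning

-- Reduction ℤ → 𝔽_p (for any p ≠ 0) preserves the ring operations.  It is
-- characterised by  reduce z ≡ z (mod p),  since an element of Fin p is
-- determined by its residue.
module ModularReduction (p : ℕ) .{{_ : NonZero p}} where
  module 𝔽p = 𝔽 p
  open +-*-Solver

  infix 4 _≋_
  -- congruence of integers modulo p (a record, so that a and b can be
  -- inferred from a proof)
  record _≋_ (a b : ℤ) : Set where
    constructor by-divisibility
    field p∣a-b : + p ∣ a ℤ.- b
  open _≋_

  ≋-from : ∀ {a b d} → a ℤ.- b ≡ d → + p ∣ d → a ≋ b
  ≋-from a-b≡d p∣d = by-divisibility (subst (+ p ∣_) (sym a-b≡d) p∣d)

  ≋-sym : ∀ {a b} → a ≋ b → b ≋ a
  ≋-sym {a} {b} a≋b =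
    ≋-from (solve 2 (λ a b → b :- a := :- (a :- b)) refl a b) (∣m⇒∣-m (p∣a-b a≋b))

  ≋-trans : ∀ {a b c} → a ≋ b → b ≋ c → a ≋ c
  ≋-trans {a} {b} {c} a≋b b≋c =
    ≋-from (solve 3 (λ a b c → a :- c := (a :- b) :+ (b :- c)) refl a b c)
           (∣m∣n⇒∣m+n (p∣a-b a≋b) (p∣a-b b≋c))

  ≡-≋-trans : ∀ {a b c} → a ≡ b → b ≋ c → a ≋ c
  ≡-≋-trans refl b≋c = b≋c

  +-cong : ∀ {a b c d} → a ≋ b → c ≋ d → a ℤ.+ c ≋ b ℤ.+ d
  +-cong {a} {b} {c} {d} a≋b c≋d =
    ≋-from (solve 4 (λ a b c d → (a :+ c) :- (b :+ d) := (a :- b) :+ (c :- d))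
                    refl a b c d)
           (∣m∣n⇒∣m+n (p∣a-b a≋b) (p∣a-b c≋d))

  *-cong : ∀ {a b c d} → a ≋ b → c ≋ d → a ℤ.* c ≋ b ℤ.* d
  *-cong {a} {b} {c} {d} a≋b c≋d =
    ≋-from (solve 4 (λ a b c d → (a :* c) :- (b :* d) := (a :- b) :* c :+ b :* (c :- d))
                    refl a b c d)
           (∣m∣n⇒∣m+n (∣m⇒∣m*n c (p∣a-b a≋b)) (∣n⇒∣m*n b (p∣a-b c≋d)))

  neg-cong : ∀ {a b} → a ≋ b → ℤ.- a ≋ ℤ.- b
  neg-cong {a} {b} a≋b =
    ≋-from (solve 2 (λ a b → (:- a) :- (:- b) := :- (a :- b)) refl a b) (∣m⇒∣-m (p∣a-b a≋b))

  mod-≋ : ∀ m → + toℕ (m mod p) ≋ + m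
  mod-≋ m = ≋-sym (≋-from m-r≡q*p (divides q refl))
    where
    open ≡-Reasoning
    r = toℕ (m mod p)
    q = + (m ℕ./ p)
    m-r≡q*p : + m ℤ.- + r ≡ q ℤ.* + p
    m-r≡q*p = begin
      + m ℤ.- + r                  ≡⟨ cong (ℤ._- + r) (a≡a%ℕn+[a/ℕn]*n (+ m) p) ⟩
      (+ (m ℕ.% p) ℤ.+ q ℤ.* + p) ℤ.- + r
                                   ≡⟨ cong (λ x → (+ x ℤ.+ q ℤ.* + p) ℤ.- + r) (toℕ-fromℕ< _) ⟨
      (+ r ℤ.+ q ℤ.* + p) ℤ.- + r  ≡⟨ solve 3 (λ r q P → (r :+ q :* P) :- r := q :* P)
                                             refl (+ r) q (+ p) ⟩
      q ℤ.* + p                    ∎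

  neg-≋ : ∀ (r : Fin p) → + toℕ (𝔽p.- r) ≋ ℤ.- + toℕ r
  neg-≋ r = ≋-trans (mod-≋ (p ℕ.∸ t)) (≋-from p∸t+t≡p (divides (+ 1) (sym (ℤP.*-identityˡ (+ p)))))
    where
    open ≡-Reasoning
    t = toℕ r
    p∸t+t≡p : + (p ℕ.∸ t) ℤ.- ℤ.- + t ≡ + p
    p∸t+t≡p = begin
      + (p ℕ.∸ t) ℤ.- ℤ.- + t   ≡⟨ cong (λ x → + (p ℕ.∸ t) ℤ.+ x) (ℤP.neg-involutive (+ t)) ⟩
      + (p ℕ.∸ t) ℤ.+ + t       ≡⟨ ℤP.pos-+ (p ℕ.∸ t) t ⟨
      + (p ℕ.∸ t ℕ.+ t)         ≡⟨ cong +_ (ℕP.m∸n+n≡m (ℕP.<⇒≤ (toℕ<n r))) ⟩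
      + p                       ∎

  reduce-≋ : ∀ z → + toℕ (𝔽p.reduce z) ≋ z
  reduce-≋ (+ m)     = mod-≋ m
  reduce-≋ -[1+ m ] = ≋-trans (neg-≋ (suc m mod p)) (neg-cong (mod-≋ (suc m)))

  -- distinct residues are incongruent: their difference is smaller than p
  ≋-injective : ∀ (r s : Fin p) → + toℕ r ≋ + toℕ s → r ≡ s
  ≋-injective r s r≋s =
    toℕ-injective (ℤP.+-injective (ℤP.i-j≡0⇒i≡j _ _ (ℤP.∣i∣≡0⇒i≡0 distance≡0)))
    where
    open ℕP.≤-Reasoning
    distance = ∣ + toℕ r ℤ.- + toℕ s ∣
    distance<p : distance ℕ.< p
    distance<p = begin-strict
      distance              ≡⟨ cong ∣_∣ (ℤP.[+m]-[+n]≡m⊖n (toℕ r) (toℕ s)) ⟩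
      ∣ toℕ r ℤ.⊖ toℕ s ∣   ≤⟨ ℤP.∣m⊝n∣≤m⊔n (toℕ r) (toℕ s) ⟩
      toℕ r ℕ.⊔ toℕ s       <⟨ ℕP.⊔-lub (toℕ<n r) (toℕ<n s) ⟩
      p                     ∎
    distance≡0 : distance ≡ 0
    distance≡0 = trans (sym (m<n⇒m%n≡m distance<p)) (n∣m⇒m%n≡0 distance p (∣⇒∣ᵤ (p∣a-b r≋s)))

  reduce-unique : ∀ (r : Fin p) z → + toℕ r ≋ z → 𝔽p.reduce z ≡ r
  reduce-unique r z r≋z = ≋-injective _ _ (≋-trans (reduce-≋ z) (≋-sym r≋z))

  reduce-+ : ∀ a b → 𝔽p.reduce (a ℤ.+ b) ≡ 𝔽p.reduce a 𝔽p.+ 𝔽p.reduce b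
  reduce-+ a b = reduce-unique _ (a ℤ.+ b)
    (≋-trans (mod-≋ _) (≡-≋-trans (ℤP.pos-+ (toℕ (𝔽p.reduce a)) _) (+-cong (reduce-≋ a) (reduce-≋ b))))

  reduce-* : ∀ a b → 𝔽p.reduce (a ℤ.* b) ≡ 𝔽p.reduce a 𝔽p.* 𝔽p.reduce b
  reduce-* a b = reduce-unique _ (a ℤ.* b)
    (≋-trans (mod-≋ _) (≡-≋-trans (ℤP.pos-* (toℕ (𝔽p.reduce a)) _) (*-cong (reduce-≋ a) (reduce-≋ b))))

  reduce-neg : ∀ a → 𝔽p.reduce (ℤ.- a) ≡ 𝔽p.- 𝔽p.reduce a
  reduce-neg a = reduce-unique _ (ℤ.- a)
    (≋-trans (neg-≋ (𝔽p.reduce a)) (neg-cong (reduce-≋ a)))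

corollary3p1 : (n : ℕ) (H : ℤX.PolyMap n) →
    (∀ i → ℤX.OrderAtLeast2 (H i)) →
    ℤX.PascalFinite (X+ H) →
    (p : ℕ) (pp : Prime p) →
    PolyOver.PascalFinite (𝔽ₚ p pp) (reduceMap p pp (X+ H)) ×
    ((G : ℤX.PolyMap n) → ℤX.IsInverse G (X+ H) →
    PolyOver.IsInverse (𝔽ₚ p pp) (reduceMap p pp G) (reduceMap p pp (X+ H)))
corollary3p1 n H _ (m , Pₘ≈0) p pp =
    (m , mapM-pascal-vanishes (X+ H) m Pₘ≈0) ,
    λ G (G∘F≈Id , F∘G≈Id) → mapM-∘M-Id G (X+ H) G∘F≈Id , mapM-∘M-Id (X+ H) G F∘G≈Id
  where
  instance
    p≢0 : NonZero p
    p≢0 = prime⇒nonZero pp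
  open ModularReduction p using (reduce-+; reduce-*; reduce-neg)
  open PolynomialHomomorphism ℤR (𝔽ₚ p pp) (reduceₚ p pp) refl refl reduce-+ reduce-* reduce-neg
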